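{- Let $A_c$ be the finite automaton with states $q_0,\dots,q_8$, initial state $q_0$, and edges $q_0\xrightarrow{\ell_1}q_1$, $q_0\xrightarrow{\ell_1}q_2$, $q_1\xrightarrow{\ell_2}q_3$, $q_2\xrightarrow{\ell_3}q_4$, $q_0\xrightarrow{h}q_5$, $q_5\xrightarrow{\ell_1}q_6$, $q_6\xrightarrow{\ell_2}q_7$, $q_6\xrightarrow{\ell_3}q_8$, with $\Sigma_h=\{h\}$, $\Sigma_l=\{\ell_1,\ell_2,\ell_3\}$ and controllable actions $\Sigma_c=\{\ell_2,\ell_3\}$. There is no most permissive controller ensuring CSNNI for $A_c$, i.e. there is no controller $C$ such that $C(A_c)$ is CSNNI and $C'(\rho)\subseteq C(\rho)$ for every run $\rho$ of $A_c$ and every controller $C'$ with $C'(A_c)$ CSNNI.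
   Context: For a finite automaton $A$ and $L\subseteq\Sigma$, $A/L$ relabels by $\varepsilon$ every edge labelled in $L$, and $A\backslash L$ deletes those edges. Write $s\xRightarrow{\varepsilon}s'$ for a (possibly empty) sequence of $\varepsilon$-steps and $\xRightarrow{a}=\xRightarrow{\varepsilon}\xrightarrow{a}\xRightarrow{\varepsilon}$. A system $T_1$ weakly simulates $T_2$ if there is a relation $\mathcal{R}$ relating the initial states such that whenever $s\,\mathcal{R}\,p$ and $p\xRightarrow{a}p'$ in $T_2$ ($a$ an action or $\varepsilon$) there is $s'$ with $s\xRightarrow{a}s'$ in $T_1$ and $s'\,\mathcal{R}\,p'$. A system is CSNNI iff its $\backslash\Sigma_h$ and $/\Sigma_h$ versions weakly simulate each other. Let $\Sigma_u=\Sigma\setminus\Sigma_c$. A controller maps each run $\rho$ of $A$ (finite path from the initial state) to a set $C(\rho)$ of enabled controllable actions; $C(A)$ is the system whose runs are defined inductively: the initial run is a run, and an extension $\rho\xrightarrow{e}q'$ (a run of $A$) of a run $\rho$ of $C(A)$ is a run of $C(A)$ iff $e\in\Sigma_u$ or $e\in\Sigma_c\cap C(\rho)$. -}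

module Defs where

open import Data.Bool using (Bool; true; false)
open import Data.Maybe using (Maybe; just; nothing)
open import Data.Product using (Σ; ∃; _×_; _,_)
open import Data.Sum using (_⊎_)
open import Relation.Binary.PropositionalEquality using (_≡_)
open import Relation.Binary.Construct.Closure.ReflexiveTransitive using (Star)

data Act : Set where
  h ℓ₁ ℓ₂ ℓ₃ : Act

isHigh : Act → Bool
isHigh h  = true
isHigh ℓ₁ = false
isHigh ℓ₂ = false
isHigh ℓ₃ = false

data CAct : Set where
  c₂ c₃ : CAct

emb : CAct → Act
emb c₂ = ℓ₂
emb c₃ = ℓ₃

-- Labels: nothing = ε, just a = action a
Label : Set
Label = Maybe Act

record LTS : Set₁ where
  field
    State : Set
    start : State
    step  : State → Label → State → Set

open LTS public

hideL : (Act → Bool) → LTS → LTS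
hideL L T = record
  { State = State T
  ; start = start T
  ; step  = st
  }
  where
  st : State T → Label → State T → Set
  st s nothing   s' = step T s nothing s' ⊎ (Σ Act λ a → (L a ≡ true) × step T s (just a) s')
  st s (just a)  s' = (L a ≡ false) × step T s (just a) s'

deleteL : (Act → Bool) → LTS → LTS
deleteL L T = record
  { State = State T
  ; start = start T
  ; step  = st
  }
  where
  st : State T → Label → State T → Set
  st s nothing   s' = step T s nothing s'
  st s (just a)  s' = (L a ≡ false) × step T s (just a) s'

EpsStar : (T : LTS) → State T → State T → Set
EpsStar T = Star (λ s s' → step T s nothing s')

WeakStep : (T : LTS) → State T → Label → State T → Set
WeakStep T s nothing  s' = EpsStar T s s'
WeakStep T s (just a) s' =
  Σ (State T) λ s₁ → Σ (State T) λ s₂ →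
    EpsStar T s s₁ × step T s₁ (just a) s₂ × EpsStar T s₂ s'

WeaklySimulates : LTS → LTS → Set₁
WeaklySimulates T₁ T₂ =
  Σ (State T₁ → State T₂ → Set) λ R →
    R (start T₁) (start T₂) ×
    (∀ s p → R s p → ∀ (l : Label) p' → WeakStep T₂ p l p' →
       Σ (State T₁) λ s' → WeakStep T₁ s l s' × R s' p')

CSNNI : LTS → Set₁
CSNNI T = WeaklySimulates (deleteL isHigh T) (hideL isHigh T)
        × WeaklySimulates (hideL isHigh T) (deleteL isHigh T)

data Q : Set where
  q₀ q₁ q₂ q₃ q₄ q₅ q₆ q₇ q₈ : Q

data Edge : Q → Act → Q → Set where
  e01 : Edge q₀ ℓ₁ q₁
  e02 : Edge q₀ ℓ₁ q₂
  e13 : Edge q₁ ℓ₂ q₃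
  e24 : Edge q₂ ℓ₃ q₄
  e05 : Edge q₀ h  q₅
  e56 : Edge q₅ ℓ₁ q₆
  e67 : Edge q₆ ℓ₂ q₇
  e68 : Edge q₆ ℓ₃ q₈

data Run : Q → Set where
  init : Run q₀
  ext  : ∀ {q a q'} → Run q → Edge q a q' → Run q'

Controller : Set
Controller = ∀ {q} → Run q → CAct → Bool

data Admits (C : Controller) {q : Q} (ρ : Run q) : Act → Set where
  unc-h  : Admits C ρ h
  unc-ℓ₁ : Admits C ρ ℓ₁
  ctrl   : (c : CAct) → C ρ c ≡ true → Admits C ρ (emb c)

data IsRunOf (C : Controller) : ∀ {q} → Run q → Set where
  init : IsRunOf C init
  ext  : ∀ {q a q'} {ρ : Run q} (e : Edge q a q') →
         IsRunOf C ρ → Admits C ρ a → IsRunOf C (ext ρ e)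

CState : Controller → Set
CState C = Σ Q λ q → Σ (Run q) λ ρ → IsRunOf C ρ

data CStep (C : Controller) : CState C → Label → CState C → Set where
  cstep : ∀ {q a q'} {ρ : Run q} (r : IsRunOf C ρ) (e : Edge q a q')
          (ok : Admits C ρ a) →
          CStep C (q , ρ , r) (just a) (q' , ext ρ e , ext e r ok)

controlled : Controller → LTS
controlled C = record
  { State = CState C
  ; start = q₀ , init , init
  ; step  = CStep C
  }

module Submission where

-- Hiding h lets the hidden system move q₀ ⇒ℓ₁ q₆, where both ℓ₂
-- and ℓ₃ are available, while the system with h deleted can only answer ℓ₁ by
-- committing to q₁ (only ℓ₂ follows) or to q₂ (only ℓ₃ follows). Hence a CSNNI
-- controller cannot enable both ℓ₂ and ℓ₃ after the run q₀ h q₅ ℓ₁ q₆. Yet the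
-- controller enabling only ℓ₂ everywhere is CSNNI, and so is the one enabling
-- only ℓ₃: identifying the high branch with the matching low branch is a weak
-- simulation. A most permissive controller would have to enable both.

open import Defs
open import Data.Bool using (true; false)
open import Data.Maybe using (just; nothing)
open import Data.Product using (Σ; _×_; _,_; proj₁)
open import Data.Sum using (inj₁; inj₂)
open import Relation.Nullary using (¬_)
open import Relation.Binary.PropositionalEquality using (_≡_; refl)
open import Relation.Binary.Construct.Closure.ReflexiveTransitive using (ε; _◅_; _◅◅_)

StepSimulation : (T₁ T₂ : LTS) → (State T₁ → State T₂ → Set) → Set
StepSimulation T₁ T₂ R =
  ∀ {s p} → R s p → ∀ {l p'} → step T₂ p l p' →
  Σ (State T₁) λ s' → WeakStep T₁ s l s' × R s' p'

module _ {T₁ T₂ : LTS} {R : State T₁ → State T₂ → Set}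
         (sim : StepSimulation T₁ T₂ R) where

  epsStar-simulation : ∀ {s p p'} → R s p → EpsStar T₂ p p' →
                       Σ (State T₁) λ s' → EpsStar T₁ s s' × R s' p'
  epsStar-simulation r ε = _ , ε , r
  epsStar-simulation r (st ◅ sts) with sim r st
  ... | _ , w₁ , r₁ with epsStar-simulation r₁ sts
  ... | s' , w₂ , r' = s' , w₁ ◅◅ w₂ , r'

  weakStep-simulation : ∀ {s p} → R s p → ∀ l {p'} → WeakStep T₂ p l p' →
                        Σ (State T₁) λ s' → WeakStep T₁ s l s' × R s' p'
  weakStep-simulation r nothing w = epsStar-simulation r w
  weakStep-simulation r (just a) (_ , _ , before , st , after)
    with epsStar-simulation r before
  ... | _ , before' , r₁ with sim r₁ st
  ... | _ , (_ , _ , pre , st' , post) , r₂ with epsStar-simulation r₂ after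
  ... | s' , after' , r' = s' , (_ , _ , before' ◅◅ pre , st' , post ◅◅ after') , r'

weaklySimulates-fromStepSimulation :
  {T₁ T₂ : LTS} (R : State T₁ → State T₂ → Set) →
  R (start T₁) (start T₂) → StepSimulation T₁ T₂ R → WeaklySimulates T₁ T₂
weaklySimulates-fromStepSimulation R R₀ sim =
  R , R₀ , λ _ _ r l _ → weakStep-simulation sim r l

hideL-weaklySimulates-deleteL : ∀ L T → WeaklySimulates (hideL L T) (deleteL L T)
hideL-weaklySimulates-deleteL L T =
  weaklySimulates-fromStepSimulation _≡_ refl sim
  where
  sim : StepSimulation (hideL L T) (deleteL L T) _≡_
  sim refl {nothing}  st = _ , inj₁ st ◅ ε , refl
  sim refl {just _}   st = _ , (_ , _ , ε , st , ε) , refl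

CSNNI-fromStepSimulation :
  (T : LTS) (R : State T → State T → Set) → R (start T) (start T) →
  StepSimulation (deleteL isHigh T) (hideL isHigh T) R → CSNNI T
CSNNI-fromStepSimulation T R R₀ sim =
  weaklySimulates-fromStepSimulation R R₀ sim , hideL-weaklySimulates-deleteL isHigh T

emb-low : ∀ c → isHigh (emb c) ≡ false
emb-low c₂ = refl
emb-low c₃ = refl

admits-emb : ∀ {C : Controller} {q} {ρ : Run q} {a} →
             Admits C ρ a → ∀ c → a ≡ emb c → C ρ c ≡ true
admits-emb (ctrl c₂ allowed) c₂ refl = allowed
admits-emb (ctrl c₃ allowed) c₃ refl = allowed
admits-emb (ctrl c₂ _)       c₃ ()
admits-emb (ctrl c₃ _)       c₂ ()
admits-emb unc-h             c₂ ()
admits-emb unc-h             c₃ ()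
admits-emb unc-ℓ₁            c₂ ()
admits-emb unc-ℓ₁            c₃ ()

-- C(A_c) has no ε-moves, so its weak moves are single moves.
weakStep-deleteL-controlled :
  ∀ L (C : Controller) {s s' a} → WeakStep (deleteL L (controlled C)) s (just a) s' →
  step (deleteL L (controlled C)) s (just a) s'
weakStep-deleteL-controlled _ _ (_ , _ , ε , st , ε) = st
weakStep-deleteL-controlled _ _ (_ , _ , () ◅ _ , _ , _)
weakStep-deleteL-controlled _ _ (_ , _ , ε , _ , () ◅ _)

branch : CAct → Q
branch c₂ = q₁
branch c₃ = q₂

enter : ∀ c → Edge q₀ ℓ₁ (branch c)
enter c₂ = e01
enter c₃ = e02

highLeaf : CAct → Q
highLeaf c₂ = q₇
highLeaf c₃ = q₈

leaveHigh : ∀ c → Edge q₆ (emb c) (highLeaf c)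
leaveHigh c₂ = e67
leaveHigh c₃ = e68

only : CAct → Controller
only c₂ _ c₂ = true
only c₃ _ c₃ = true
only _  _ _  = false

only-self : ∀ c {q} (ρ : Run q) → only c ρ c ≡ true
only-self c₂ _ = refl
only-self c₃ _ = refl

only-allows⇒≡ : ∀ c c' {q} {ρ : Run q} → only c ρ c' ≡ true → c ≡ c'
only-allows⇒≡ c₂ c₂ _ = refl
only-allows⇒≡ c₃ c₃ _ = refl
only-allows⇒≡ c₂ c₃ ()
only-allows⇒≡ c₃ c₂ ()

admits-only : ∀ c {q q'} {ρ : Run q} {ρ' : Run q'} {a} →
              Admits (only c) ρ a → Admits (only c) ρ' a
admits-only c unc-h            = unc-h
admits-only c unc-ℓ₁           = unc-ℓ₁
admits-only c (ctrl c' allows) = ctrl c' allows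

collapse : CAct → Q → Q
collapse c q₅ = q₀
collapse c q₆ = branch c
collapse c q₇ = q₃
collapse c q₈ = q₄
collapse c q  = q

collapse-edge : ∀ c {q a q'} {ρ : Run q} → Edge q a q' → isHigh a ≡ false →
                Admits (only c) ρ a → Edge (collapse c q) a (collapse c q')
collapse-edge c e01 _ _ = e01
collapse-edge c e02 _ _ = e02
collapse-edge c e13 _ _ = e13
collapse-edge c e24 _ _ = e24
collapse-edge c e05 () _
collapse-edge c e56 _ _ = enter c
collapse-edge c {ρ = ρ} e67 _ ok with only-allows⇒≡ c c₂ {ρ = ρ} (admits-emb ok c₂ refl)
... | refl = e13
collapse-edge c {ρ = ρ} e68 _ ok with only-allows⇒≡ c c₃ {ρ = ρ} (admits-emb ok c₃ refl)
... | refl = e24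

only-CSNNI : ∀ c → CSNNI (controlled (only c))
only-CSNNI c = CSNNI-fromStepSimulation _ R refl sim
  where
  T : LTS
  T = controlled (only c)

  R : CState (only c) → CState (only c) → Set
  R s p = proj₁ s ≡ collapse c (proj₁ p)

  sim : StepSimulation (deleteL isHigh T) (hideL isHigh T) R
  sim r {nothing} (inj₁ ())
  sim r {nothing} (inj₂ (h , _ , cstep _ e05 _)) = _ , ε , r
  sim r {nothing} (inj₂ (ℓ₁ , () , _))
  sim r {nothing} (inj₂ (ℓ₂ , () , _))
  sim r {nothing} (inj₂ (ℓ₃ , () , _))
  sim {_ , _ , rs} refl {just _} (low , cstep _ e ok) =
    _ , (_ , _ , ε , (low , cstep rs (collapse-edge c e low ok) (admits-only c ok)) , ε) , refl

ρ₆ : Run q₆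
ρ₆ = ext (ext init e05) e56

ℓ₁-successor-blocked :
  ∀ {C : Controller} {s} →
  step (deleteL isHigh (controlled C)) (start (controlled C)) (just ℓ₁) s →
  Σ CAct λ c → ∀ {s'} → ¬ step (deleteL isHigh (controlled C)) s (just (emb c)) s'
ℓ₁-successor-blocked (_ , cstep _ e01 _) = c₃ , λ { (_ , cstep _ () _) }
ℓ₁-successor-blocked (_ , cstep _ e02 _) = c₂ , λ { (_ , cstep _ () _) }

allowingAll-after-ρ₆⇒¬CSNNI : (C : Controller) → (∀ c → C ρ₆ c ≡ true) → ¬ CSNNI (controlled C)
allowingAll-after-ρ₆⇒¬CSNNI C allowed ((R , R₀ , sim) , _)
  with sim _ _ R₀ (just ℓ₁) p₆ (_ , _ , hide-h ◅ ε , (refl , cstep r₅ e56 unc-ℓ₁) , ε)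
  where
  r₅ : IsRunOf C (ext init e05)
  r₅ = ext e05 init unc-h
  p₆ : CState C
  p₆ = q₆ , ρ₆ , ext e56 r₅ unc-ℓ₁
  hide-h : step (hideL isHigh (controlled C)) (start (controlled C)) nothing (q₅ , _ , r₅)
  hide-h = inj₂ (h , refl , cstep init e05 unc-h)
... | s , w , Rsp with ℓ₁-successor-blocked {C} (weakStep-deleteL-controlled isHigh C w)
... | c , blocked
  with sim s _ Rsp (just (emb c)) _
         (_ , _ , ε , (emb-low c , cstep _ (leaveHigh c) (ctrl c (allowed c))) , ε)
... | _ , w' , _ = blocked (weakStep-deleteL-controlled isHigh C w')

proposition3 : ¬ (Σ Controller λ C → CSNNI (controlled C) ×
    (∀ (C' : Controller) → CSNNI (controlled C') →
    ∀ {q} (ρ : Run q) (c : CAct) → C' ρ c ≡ true → C ρ c ≡ true))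
proposition3 (C , csnni , mostPermissive) =
  allowingAll-after-ρ₆⇒¬CSNNI C allowed csnni
  where
  allowed : ∀ c → C ρ₆ c ≡ true
  allowed c = mostPermissive (only c) (only-CSNNI c) ρ₆ c (only-self c ρ₆)
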